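{- Let $k\geq 1$ and let $W$ be the set of vertices of $\widetilde\Omega_{2k}$ of weight $(k-1,k+1)$. If $[\mathbf{u}]$ and $[\mathbf{w}]$ are distinct odd vertices of $\widetilde\Omega_{2k}$, then $N([\mathbf{u}])\cap W \neq N([\mathbf{w}])\cap W$; that is, each odd vertex of $\widetilde\Omega_{2k}$ has a unique set of neighbors among the vertices of weight $(k-1,k+1)$.
   Context: The orthogonality graph $\Omega_{2k}$ has vertex set $\mathbb{Z}_2^{2k}$ (bitstrings of length $2k$), with two vertices adjacent if and only if they differ in exactly $k$ positions. Let $\mathbf{1}$ be the all-ones bitstring and $+$ bitwise addition mod 2. The weight $\mathrm{wt}(\mathbf{x})$ is the number of 1s in $\mathbf{x}$. The quotient graph $\widetilde\Omega_{2k}$ has vertices $[\mathbf{u}]=\{\mathbf{u},\mathbf{u}+\mathbf{1}\}$, with $[\mathbf{u}]$ adjacent to $[\mathbf{x}]$ iff some element of $[\mathbf{u}]$ is adjacent in $\Omega_{2k}$ to some element of $[\mathbf{x}]$ (equivalently iff $\mathbf{u}$ is adjacent to $\mathbf{x}$). The weight of $[\mathbf{x}]$ is the pair $(\mathrm{wt}(\mathbf{x}), 2k-\mathrm{wt}(\mathbf{x}))$, where the representative is chosen with $\mathrm{wt}(\mathbf{x})\leq k$. A vertex $[\mathbf{x}]$ is odd if $\mathrm{wt}(\mathbf{x})$ is odd (this does not depend on the representative). $N(\cdot)$ denotes the neighborhood in $\widetilde\Omega_{2k}$. -}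

module Defs where

open import Data.Bool using (Bool; true; false; _xor_)
open import Data.Nat using (ℕ; zero; suc; _+_; _*_; _∸_; _%_)
open import Data.Vec using (Vec; []; _∷_; zipWith; replicate)
open import Relation.Binary.PropositionalEquality using (_≡_)
open import Data.Sum using (_⊎_)

Bits : ℕ → Set
Bits n = Vec Bool n

wt : ∀ {n} → Bits n → ℕ
wt [] = 0
wt (true ∷ xs) = suc (wt xs)
wt (false ∷ xs) = wt xs

_⊕_ : ∀ {n} → Bits n → Bits n → Bits n
_⊕_ = zipWith _xor_

𝟏 : ∀ {n} → Bits n
𝟏 = replicate _ true

dist : ∀ {n} → Bits n → Bits n → ℕ
dist x y = wt (x ⊕ y)

Adj : (k : ℕ) → Bits (2 * k) → Bits (2 * k) → Set
Adj k x y = dist x y ≡ k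

-- Vertices of the quotient graph are classes [u] = {u, u + 1}, represented
-- by any element u.  Two representatives give the same vertex iff:
SameClass : ∀ {n} → Bits n → Bits n → Set
SameClass u w = (w ≡ u) ⊎ (w ≡ u ⊕ 𝟏)

-- [u] ~ [x] in the quotient graph iff u is adjacent to x in Ω_{2k}
QAdj : (k : ℕ) → Bits (2 * k) → Bits (2 * k) → Set
QAdj k u x = Adj k u x

-- [x] is odd iff wt x is odd (independent of representative)
Odd : ∀ {n} → Bits n → Set
Odd x = wt x % 2 ≡ 1

-- [x] has weight (k-1, k+1): the representative of weight ≤ k has weight k-1,
-- i.e. wt x ∈ {k-1, k+1}
InW : (k : ℕ) → Bits (2 * k) → Set
InW k x = (wt x ≡ k ∸ 1) ⊎ (wt x ≡ k + 1)

-- Split the positions i by the pair (u i , w i).  Since u is odd, the region where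
-- u is 0 and the region where u is 1 have odd sizes 2j+1 and 2m+1, and k = 1 + m + j.
-- A vector x with j ones on the first region and m ones on the second is then a
-- neighbour of u of weight k - 1.  As w is odd and [w] ≠ [u], in one of the two
-- regions w takes both values, so a one of x can be moved there from a position
-- where w is 1 to a position where w is 0.  The result is still a neighbour of u
-- in W, but its distance to w has grown by 2, so w is not adjacent to both.
module Submission where

open import Defs
open import Data.Nat using (ℕ; _≥_; _*_)
open import Relation.Nullary using (¬_)
open import Function using (_⇔_)

open import Data.Bool using (true; false)
open import Data.Nat using (zero; suc; _+_; _/_; _%_; _<_; _≤_)
open import Data.Nat.Properties
  using (+-suc; +-comm; *-comm; +-identityʳ; suc-injective; +-cancelʳ-≡;
         0≢1+n; m+1+n≢0; m≢1+n+m; m+n≡0⇒m≡0; m+n≡0⇒n≡0;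
         1+n≰n; ≰⇒>; ≤-trans; m≤n+m; +-mono-≤; m≤n⇒∃[o]m+o≡n)
open import Data.Nat.DivMod using (m≡m%n+[m/n]*n; m*n%n≡0)
open import Data.Nat.Tactic.RingSolver using (solve-∀)
open import Data.Vec using ([]; _∷_)
open import Data.Product using (Σ-syntax; _×_; _,_)
open import Data.Sum using (_⊎_; inj₁; inj₂)
open import Data.Empty using (⊥; ⊥-elim)
open import Relation.Binary.PropositionalEquality
  using (_≡_; _≢_; refl; sym; trans; cong; cong₂; subst; module ≡-Reasoning)
open import Function.Bundles using (Equivalence)

#₀₀ #₀₁ #₁₀ #₁₁ : ∀ {n} → Bits n → Bits n → ℕ
#₀₀ []          []          = 0
#₀₀ (false ∷ u) (false ∷ w) = suc (#₀₀ u w)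
#₀₀ (_ ∷ u)     (_ ∷ w)     = #₀₀ u w
#₀₁ []          []          = 0
#₀₁ (false ∷ u) (true ∷ w)  = suc (#₀₁ u w)
#₀₁ (_ ∷ u)     (_ ∷ w)     = #₀₁ u w
#₁₀ []          []          = 0
#₁₀ (true ∷ u)  (false ∷ w) = suc (#₁₀ u w)
#₁₀ (_ ∷ u)     (_ ∷ w)     = #₁₀ u w
#₁₁ []          []          = 0
#₁₁ (true ∷ u)  (true ∷ w)  = suc (#₁₁ u w)
#₁₁ (_ ∷ u)     (_ ∷ w)     = #₁₁ u w

#-total : ∀ {n} (u w : Bits n) → (#₀₀ u w + #₀₁ u w) + (#₁₀ u w + #₁₁ u w) ≡ n
#-total []          []          = refl
#-total (false ∷ u) (false ∷ w) = cong suc (#-total u w)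
#-total (false ∷ u) (true ∷ w)  =
  trans (cong (_+ (#₁₀ u w + #₁₁ u w)) (+-suc (#₀₀ u w) (#₀₁ u w))) (cong suc (#-total u w))
#-total (true ∷ u)  (false ∷ w) =
  trans (+-suc (#₀₀ u w + #₀₁ u w) (#₁₀ u w + #₁₁ u w)) (cong suc (#-total u w))
#-total (true ∷ u)  (true ∷ w)  =
  trans (cong ((#₀₀ u w + #₀₁ u w) +_) (+-suc (#₁₀ u w) (#₁₁ u w)))
    (trans (+-suc (#₀₀ u w + #₀₁ u w) (#₁₀ u w + #₁₁ u w)) (cong suc (#-total u w)))

wt≡#₁₀+#₁₁ : ∀ {n} (u w : Bits n) → wt u ≡ #₁₀ u w + #₁₁ u w
wt≡#₁₀+#₁₁ []          []          = refl
wt≡#₁₀+#₁₁ (false ∷ u) (_ ∷ w)     = wt≡#₁₀+#₁₁ u w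
wt≡#₁₀+#₁₁ (true ∷ u)  (false ∷ w) = cong suc (wt≡#₁₀+#₁₁ u w)
wt≡#₁₀+#₁₁ (true ∷ u)  (true ∷ w)  =
  trans (cong suc (wt≡#₁₀+#₁₁ u w)) (sym (+-suc (#₁₀ u w) (#₁₁ u w)))

wt≡#₀₁+#₁₁ : ∀ {n} (u w : Bits n) → wt w ≡ #₀₁ u w + #₁₁ u w
wt≡#₀₁+#₁₁ []          []          = refl
wt≡#₀₁+#₁₁ (false ∷ u) (false ∷ w) = wt≡#₀₁+#₁₁ u w
wt≡#₀₁+#₁₁ (true ∷ u)  (false ∷ w) = wt≡#₀₁+#₁₁ u w
wt≡#₀₁+#₁₁ (false ∷ u) (true ∷ w)  = cong suc (wt≡#₀₁+#₁₁ u w)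
wt≡#₀₁+#₁₁ (true ∷ u)  (true ∷ w)  =
  trans (cong suc (wt≡#₀₁+#₁₁ u w)) (sym (+-suc (#₀₁ u w) (#₁₁ u w)))

#₀₁≡0⇒#₁₀≡0⇒w≡u : ∀ {n} (u w : Bits n) → #₀₁ u w ≡ 0 → #₁₀ u w ≡ 0 → w ≡ u
#₀₁≡0⇒#₁₀≡0⇒w≡u []          []          _  _  = refl
#₀₁≡0⇒#₁₀≡0⇒w≡u (false ∷ u) (false ∷ w) e₀₁ e₁₀ = cong (false ∷_) (#₀₁≡0⇒#₁₀≡0⇒w≡u u w e₀₁ e₁₀)
#₀₁≡0⇒#₁₀≡0⇒w≡u (true ∷ u)  (true ∷ w)  e₀₁ e₁₀ = cong (true ∷_) (#₀₁≡0⇒#₁₀≡0⇒w≡u u w e₀₁ e₁₀)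

#₀₀≡0⇒#₁₁≡0⇒w≡u⊕𝟏 : ∀ {n} (u w : Bits n) → #₀₀ u w ≡ 0 → #₁₁ u w ≡ 0 → w ≡ u ⊕ 𝟏
#₀₀≡0⇒#₁₁≡0⇒w≡u⊕𝟏 []          []          _   _   = refl
#₀₀≡0⇒#₁₁≡0⇒w≡u⊕𝟏 (false ∷ u) (true ∷ w)  e₀₀ e₁₁ = cong (true ∷_) (#₀₀≡0⇒#₁₁≡0⇒w≡u⊕𝟏 u w e₀₀ e₁₁)
#₀₀≡0⇒#₁₁≡0⇒w≡u⊕𝟏 (true ∷ u)  (false ∷ w) e₀₀ e₁₁ = cong (false ∷_) (#₀₀≡0⇒#₁₁≡0⇒w≡u⊕𝟏 u w e₀₀ e₁₁)

private
  suc-inˡ : ∀ a b c → (a + suc b) + c ≡ suc ((a + b) + c)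
  suc-inˡ = solve-∀

  suc-inʳ : ∀ a b c → a + (b + suc c) ≡ suc (a + (b + c))
  suc-inʳ = solve-∀

-- oₐₐ′ and zₐₐ′ count the ones and zeros that x puts on the positions i with
-- (u i , w i) = (a , a′).
realise-profile : ∀ {n} (u w : Bits n) (o₀₀ z₀₀ o₀₁ z₀₁ o₁₀ z₁₀ o₁₁ z₁₁ : ℕ) →
  #₀₀ u w ≡ o₀₀ + z₀₀ → #₀₁ u w ≡ o₀₁ + z₀₁ → #₁₀ u w ≡ o₁₀ + z₁₀ → #₁₁ u w ≡ o₁₁ + z₁₁ →
  Σ[ x ∈ Bits n ] dist u x ≡ (o₀₀ + o₀₁) + (z₁₀ + z₁₁)
                × wt x ≡ (o₀₀ + o₀₁) + (o₁₀ + o₁₁)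
                × dist w x ≡ (o₀₀ + z₀₁) + (o₁₀ + z₁₁)
realise-profile [] [] o₀₀ _ o₀₁ _ o₁₀ _ o₁₁ _ e₀₀ e₀₁ e₁₀ e₁₁
  with both≡0 o₀₀ e₀₀ | both≡0 o₀₁ e₀₁ | both≡0 o₁₀ e₁₀ | both≡0 o₁₁ e₁₁
  where
  both≡0 : ∀ o {z} → 0 ≡ o + z → o ≡ 0 × z ≡ 0
  both≡0 o e = m+n≡0⇒m≡0 o (sym e) , m+n≡0⇒n≡0 o (sym e)
... | refl , refl | refl , refl | refl , refl | refl , refl = [] , refl , refl , refl
realise-profile (false ∷ u) (false ∷ w) (suc o₀₀) z₀₀ o₀₁ z₀₁ o₁₀ z₁₀ o₁₁ z₁₁ e₀₀ e₀₁ e₁₀ e₁₁ =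
  let x , d , t , d′ = realise-profile u w o₀₀ z₀₀ o₀₁ z₀₁ o₁₀ z₁₀ o₁₁ z₁₁
                         (suc-injective e₀₀) e₀₁ e₁₀ e₁₁
  in true ∷ x , cong suc d , cong suc t , cong suc d′
realise-profile (false ∷ u) (false ∷ w) zero (suc z₀₀) o₀₁ z₀₁ o₁₀ z₁₀ o₁₁ z₁₁ e₀₀ e₀₁ e₁₀ e₁₁ =
  let x , d , t , d′ = realise-profile u w 0 z₀₀ o₀₁ z₀₁ o₁₀ z₁₀ o₁₁ z₁₁
                         (suc-injective e₀₀) e₀₁ e₁₀ e₁₁
  in false ∷ x , d , t , d′
realise-profile (false ∷ u) (false ∷ w) zero zero _ _ _ _ _ _ () _ _ _
realise-profile (false ∷ u) (true ∷ w) o₀₀ z₀₀ (suc o₀₁) z₀₁ o₁₀ z₁₀ o₁₁ z₁₁ e₀₀ e₀₁ e₁₀ e₁₁ =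
  let x , d , t , d′ = realise-profile u w o₀₀ z₀₀ o₀₁ z₀₁ o₁₀ z₁₀ o₁₁ z₁₁
                         e₀₀ (suc-injective e₀₁) e₁₀ e₁₁
  in true ∷ x , trans (cong suc d) (sym (suc-inˡ o₀₀ o₀₁ (z₁₀ + z₁₁)))
              , trans (cong suc t) (sym (suc-inˡ o₀₀ o₀₁ (o₁₀ + o₁₁))) , d′
realise-profile (false ∷ u) (true ∷ w) o₀₀ z₀₀ zero (suc z₀₁) o₁₀ z₁₀ o₁₁ z₁₁ e₀₀ e₀₁ e₁₀ e₁₁ =
  let x , d , t , d′ = realise-profile u w o₀₀ z₀₀ 0 z₀₁ o₁₀ z₁₀ o₁₁ z₁₁
                         e₀₀ (suc-injective e₀₁) e₁₀ e₁₁
  in false ∷ x , d , t , trans (cong suc d′) (sym (suc-inˡ o₀₀ z₀₁ (o₁₀ + z₁₁)))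
realise-profile (false ∷ u) (true ∷ w) _ _ zero zero _ _ _ _ _ () _ _
realise-profile (true ∷ u) (false ∷ w) o₀₀ z₀₀ o₀₁ z₀₁ (suc o₁₀) z₁₀ o₁₁ z₁₁ e₀₀ e₀₁ e₁₀ e₁₁ =
  let x , d , t , d′ = realise-profile u w o₀₀ z₀₀ o₀₁ z₀₁ o₁₀ z₁₀ o₁₁ z₁₁
                         e₀₀ e₀₁ (suc-injective e₁₀) e₁₁
  in true ∷ x , d , trans (cong suc t) (sym (+-suc (o₀₀ + o₀₁) (o₁₀ + o₁₁)))
              , trans (cong suc d′) (sym (+-suc (o₀₀ + z₀₁) (o₁₀ + z₁₁)))
realise-profile (true ∷ u) (false ∷ w) o₀₀ z₀₀ o₀₁ z₀₁ zero (suc z₁₀) o₁₁ z₁₁ e₀₀ e₀₁ e₁₀ e₁₁ =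
  let x , d , t , d′ = realise-profile u w o₀₀ z₀₀ o₀₁ z₀₁ 0 z₁₀ o₁₁ z₁₁
                         e₀₀ e₀₁ (suc-injective e₁₀) e₁₁
  in false ∷ x , trans (cong suc d) (sym (+-suc (o₀₀ + o₀₁) (z₁₀ + z₁₁))) , t , d′
realise-profile (true ∷ u) (false ∷ w) _ _ _ _ zero zero _ _ _ _ () _
realise-profile (true ∷ u) (true ∷ w) o₀₀ z₀₀ o₀₁ z₀₁ o₁₀ z₁₀ (suc o₁₁) z₁₁ e₀₀ e₀₁ e₁₀ e₁₁ =
  let x , d , t , d′ = realise-profile u w o₀₀ z₀₀ o₀₁ z₀₁ o₁₀ z₁₀ o₁₁ z₁₁
                         e₀₀ e₀₁ e₁₀ (suc-injective e₁₁)
  in true ∷ x , d , trans (cong suc t) (sym (suc-inʳ (o₀₀ + o₀₁) o₁₀ o₁₁)) , d′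
realise-profile (true ∷ u) (true ∷ w) o₀₀ z₀₀ o₀₁ z₀₁ o₁₀ z₁₀ zero (suc z₁₁) e₀₀ e₀₁ e₁₀ e₁₁ =
  let x , d , t , d′ = realise-profile u w o₀₀ z₀₀ o₀₁ z₀₁ o₁₀ z₁₀ 0 z₁₁
                         e₀₀ e₀₁ e₁₀ (suc-injective e₁₁)
  in false ∷ x , trans (cong suc d) (sym (suc-inʳ (o₀₀ + o₀₁) z₁₀ z₁₁)) , t
               , trans (cong suc d′) (sym (suc-inʳ (o₀₀ + z₀₁) o₁₀ z₁₁))
realise-profile (true ∷ u) (true ∷ w) _ _ _ _ _ _ zero zero _ _ _ ()

split-+ : ∀ X Y t t′ → X + Y ≡ t + t′ →
  Σ[ (o , z , o′ , z′) ∈ ℕ × ℕ × ℕ × ℕ ]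
    X ≡ o + z × Y ≡ o′ + z′ × o + o′ ≡ t × z + z′ ≡ t′
split-+ X Y zero t′ eq = (0 , X , 0 , Y) , refl , refl , refl , eq
split-+ (suc X) Y (suc t) t′ eq =
  let (o , z , o′ , z′) , eX , eY , eo , ez = split-+ X Y t t′ (suc-injective eq)
  in (suc o , z , o′ , z′) , cong suc eX , eY , cong suc eo , ez
split-+ zero (suc Y) (suc t) t′ eq =
  let (o , z , o′ , z′) , eX , eY , eo , ez = split-+ 0 Y t t′ (suc-injective eq)
  in (o , z , suc o′ , z′) , eX , cong suc eY , trans (+-suc o o′) (cong suc eo) , ez
split-+ zero zero (suc t) t′ ()

odd⇒≡1+[/2+/2] : ∀ n → n % 2 ≡ 1 → n ≡ suc (n / 2 + n / 2)
odd⇒≡1+[/2+/2] n odd = trans (m≡m%n+[m/n]*n n 2) (cong₂ _+_ odd (double (n / 2)))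
  where
  double : ∀ q → q * 2 ≡ q + q
  double = solve-∀

2*k%2≢1 : ∀ k → 2 * k % 2 ≢ 1
2*k%2≢1 k odd = 0≢1+n (trans (sym (trans (cong (_% 2) (*-comm 2 k)) (m*n%n≡0 k 2))) odd)

odd-complement : ∀ {X m k} → X + suc (m + m) ≡ k + k →
  Σ[ j ∈ ℕ ] X ≡ suc (j + j) × k ≡ suc (m + j)
odd-complement {X} {m} {k} eq =
  let j , 1+m+j≡k = m≤n⇒∃[o]m+o≡n m<k
  in j , +-cancelʳ-≡ (suc (m + m)) X (suc (j + j))
           (trans eq (trans (cong₂ _+_ (sym 1+m+j≡k) (sym 1+m+j≡k)) (regroup m j)))
       , sym 1+m+j≡k
  where
  m<k : m < k
  m<k = ≰⇒> λ k≤m → 1+n≰n (≤-trans (subst (suc (m + m) ≤_) eq (m≤n+m _ X)) (+-mono-≤ k≤m k≤m))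
  regroup : ∀ m j → suc (m + j) + suc (m + j) ≡ suc (j + j) + suc (m + m)
  regroup = solve-∀

odd-sum-of-sucs : ∀ a b j → suc a + suc b ≡ suc (j + j) →
  Σ[ j₀ ∈ ℕ ] j ≡ suc j₀ × a + b ≡ j₀ + suc j₀
odd-sum-of-sucs a b zero     eq = ⊥-elim (m+1+n≢0 a (suc-injective eq))
odd-sum-of-sucs a b (suc j₀) eq =
  j₀ , refl , suc-injective (trans (sym (+-suc a b)) (suc-injective eq))

record Separation {n} (u w : Bits n) (j m : ℕ) : Set where
  field
    x₁ x₂   : Bits n
    dist-x₁ : dist u x₁ ≡ j + suc m
    dist-x₂ : dist u x₂ ≡ j + suc m
    wt-x₁   : wt x₁ ≡ j + m
    wt-x₂   : wt x₂ ≡ j + m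
    gap     : dist w x₂ ≡ 2 + dist w x₁

private
  two-moreˡ : ∀ a b c → (suc a + suc b) + c ≡ 2 + ((a + b) + c)
  two-moreˡ = solve-∀

  two-moreʳ : ∀ a b c → a + (suc b + suc c) ≡ 2 + (a + (b + c))
  two-moreʳ = solve-∀

-- x₂ is x₁ with a one moved from a position where (u i , w i) = (0 , 1) to one
-- where (u i , w i) = (0 , 0).
separation-in-region₀ : ∀ {n j m a b C E} (u w : Bits n) →
  #₀₀ u w ≡ suc a → #₀₁ u w ≡ suc b → #₁₀ u w ≡ C → #₁₁ u w ≡ E →
  suc a + suc b ≡ suc (j + j) → C + E ≡ suc (m + m) → Separation u w j m
separation-in-region₀ {j = j} {m} {a} {b} {C} {E} u w e₀₀ e₀₁ e₁₀ e₁₁ eA+B eC+E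
  with odd-sum-of-sucs a b j eA+B
... | j₀ , refl , ea+b
  with split-+ a b j₀ (suc j₀) ea+b | split-+ C E m (suc m) (trans eC+E (sym (+-suc m m)))
... | (a₁ , a₀ , b₁ , b₀) , refl , refl , refl , _ | (c₁ , c₀ , e₁ , e₀) , refl , refl , refl , ez =
  let x₁ , d₁ , t₁ , d₁′ = realise-profile u w a₁ (suc a₀) (suc b₁) b₀ c₁ c₀ e₁ e₀
                             (trans e₀₀ (sym (+-suc a₁ a₀))) e₀₁ e₁₀ e₁₁
      x₂ , d₂ , t₂ , d₂′ = realise-profile u w (suc a₁) a₀ b₁ (suc b₀) c₁ c₀ e₁ e₀
                             e₀₀ (trans e₀₁ (sym (+-suc b₁ b₀))) e₁₀ e₁₁
  in record
    { x₁ = x₁ ; x₂ = x₂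
    ; dist-x₁ = trans d₁ (cong₂ _+_ (+-suc a₁ b₁) ez)
    ; dist-x₂ = trans d₂ (cong (suc (a₁ + b₁) +_) ez)
    ; wt-x₁ = trans t₁ (cong (_+ (c₁ + e₁)) (+-suc a₁ b₁))
    ; wt-x₂ = t₂
    ; gap = trans d₂′ (trans (two-moreˡ a₁ b₀ (c₁ + e₀)) (cong (2 +_) (sym d₁′)))
    }

-- x₂ is x₁ with a one moved from a position where (u i , w i) = (1 , 1) to one
-- where (u i , w i) = (1 , 0).
separation-in-region₁ : ∀ {n j m A B c e} (u w : Bits n) →
  #₀₀ u w ≡ A → #₀₁ u w ≡ B → #₁₀ u w ≡ suc c → #₁₁ u w ≡ suc e →
  A + B ≡ suc (j + j) → suc c + suc e ≡ suc (m + m) → Separation u w j m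
separation-in-region₁ {j = j} {m} {A} {B} {c} {e} u w e₀₀ e₀₁ e₁₀ e₁₁ eA+B eC+E
  with odd-sum-of-sucs c e m eC+E
... | m₀ , refl , ec+e
  with split-+ A B j (suc j) (trans eA+B (sym (+-suc j j))) | split-+ c e m₀ (suc m₀) ec+e
... | (a₁ , a₀ , b₁ , b₀) , refl , refl , refl , _ | (c₁ , c₀ , e₁ , e₀) , refl , refl , refl , ez =
  let x₁ , d₁ , t₁ , d₁′ = realise-profile u w a₁ a₀ b₁ b₀ c₁ (suc c₀) (suc e₁) e₀
                             e₀₀ e₀₁ (trans e₁₀ (sym (+-suc c₁ c₀))) e₁₁
      x₂ , d₂ , t₂ , d₂′ = realise-profile u w a₁ a₀ b₁ b₀ (suc c₁) c₀ e₁ (suc e₀)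
                             e₀₀ e₀₁ e₁₀ (trans e₁₁ (sym (+-suc e₁ e₀)))
  in record
    { x₁ = x₁ ; x₂ = x₂
    ; dist-x₁ = trans d₁ (cong (λ z → (a₁ + b₁) + suc z) ez)
    ; dist-x₂ = trans d₂ (cong ((a₁ + b₁) +_) (trans (+-suc c₀ e₀) (cong suc ez)))
    ; wt-x₁ = trans t₁ (cong ((a₁ + b₁) +_) (+-suc c₁ e₁))
    ; wt-x₂ = t₂
    ; gap = trans d₂′ (trans (two-moreʳ (a₁ + b₀) c₁ e₀) (cong (2 +_) (sym d₁′)))
    }

separation : ∀ {n j m A B C E} (u w : Bits n) →
  #₀₀ u w ≡ A → #₀₁ u w ≡ B → #₁₀ u w ≡ C → #₁₁ u w ≡ E →
  A + B ≡ suc (j + j) → C + E ≡ suc (m + m) →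
  ((A ≡ 0 ⊎ B ≡ 0) → (C ≡ 0 ⊎ E ≡ 0) → ⊥) → Separation u w j m
separation {A = suc _} {suc _} u w e₀₀ e₀₁ e₁₀ e₁₁ eA+B eC+E _ =
  separation-in-region₀ u w e₀₀ e₀₁ e₁₀ e₁₁ eA+B eC+E
separation {C = suc _} {suc _} u w e₀₀ e₀₁ e₁₀ e₁₁ eA+B eC+E _ =
  separation-in-region₁ u w e₀₀ e₀₁ e₁₀ e₁₁ eA+B eC+E
separation {A = zero} {C = zero} _ _ _ _ _ _ _ _ mixed = ⊥-elim (mixed (inj₁ refl) (inj₁ refl))
separation {A = zero} {E = zero} _ _ _ _ _ _ _ _ mixed = ⊥-elim (mixed (inj₁ refl) (inj₂ refl))
separation {B = zero} {C = zero} _ _ _ _ _ _ _ _ mixed = ⊥-elim (mixed (inj₂ refl) (inj₁ refl))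
separation {B = zero} {E = zero} _ _ _ _ _ _ _ _ mixed = ⊥-elim (mixed (inj₂ refl) (inj₂ refl))

some-region-mixed : ∀ {k} (u w : Bits (2 * k)) → Odd w → ¬ SameClass u w →
  (#₀₀ u w ≡ 0 ⊎ #₀₁ u w ≡ 0) → (#₁₀ u w ≡ 0 ⊎ #₁₁ u w ≡ 0) → ⊥
some-region-mixed {k} u w odd-w _ (inj₁ #₀₀≡0) (inj₁ #₁₀≡0) =
  2*k%2≢1 k (subst (λ t → t % 2 ≡ 1) wt-w≡2*k odd-w)
  where
  wt-w≡2*k : wt w ≡ 2 * k
  wt-w≡2*k = trans (wt≡#₀₁+#₁₁ u w)
    (trans (cong₂ (λ a c → (a + #₀₁ u w) + (c + #₁₁ u w)) (sym #₀₀≡0) (sym #₁₀≡0)) (#-total u w))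
some-region-mixed u w _ u≁w (inj₁ #₀₀≡0) (inj₂ #₁₁≡0) =
  u≁w (inj₂ (#₀₀≡0⇒#₁₁≡0⇒w≡u⊕𝟏 u w #₀₀≡0 #₁₁≡0))
some-region-mixed u w _ u≁w (inj₂ #₀₁≡0) (inj₁ #₁₀≡0) =
  u≁w (inj₁ (#₀₁≡0⇒#₁₀≡0⇒w≡u u w #₀₁≡0 #₁₀≡0))
some-region-mixed u w odd-w _ (inj₂ #₀₁≡0) (inj₂ #₁₁≡0) =
  0≢1+n (trans (sym (cong (_% 2) (trans (wt≡#₀₁+#₁₁ u w) (cong₂ _+_ #₀₁≡0 #₁₁≡0)))) odd-w)

separation-of-odd : ∀ {k} (u w : Bits (2 * k)) → Odd u → Odd w → ¬ SameClass u w →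
  Σ[ (j , m) ∈ ℕ × ℕ ] k ≡ suc (m + j) × Separation u w j m
separation-of-odd {k} u w odd-u odd-w u≁w =
  let j , eA+B , k≡1+m+j = odd-complement
        (trans (cong ((#₀₀ u w + #₀₁ u w) +_) (sym eC+E))
          (trans (#-total u w) (cong (k +_) (+-identityʳ k))))
  in (j , m) , k≡1+m+j
     , separation u w refl refl refl refl eA+B eC+E (some-region-mixed {k} u w odd-w u≁w)
  where
  m : ℕ
  m = wt u / 2
  eC+E : #₁₀ u w + #₁₁ u w ≡ suc (m + m)
  eC+E = trans (sym (wt≡#₁₀+#₁₁ u w)) (odd⇒≡1+[/2+/2] (wt u) odd-u)

neighbour-in-W : ∀ {k j m} (u x : Bits (2 * k)) → k ≡ suc (m + j) →
  dist u x ≡ j + suc m → wt x ≡ j + m → QAdj k u x × InW k x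
neighbour-in-W {j = j} {m} u x refl d t =
  trans d (trans (+-suc j m) (cong suc (+-comm j m))) , inj₁ (trans t (+-comm j m))

proposition2 : (k : ℕ) → k ≥ 1 → (u w : Bits (2 * k)) →
    Odd u → Odd w → ¬ SameClass u w →
    ¬ ((x : Bits (2 * k)) → InW k x → (QAdj k u x ⇔ QAdj k w x))
proposition2 k _ u w odd-u odd-w u≁w same-neighbours
  with separation-of-odd {k} u w odd-u odd-w u≁w
... | (j , m) , k≡1+m+j , sep = m≢1+n+m k (begin
  k               ≡⟨ sym (adjacent-to-w x₂ dist-x₂ wt-x₂) ⟩
  dist w x₂       ≡⟨ gap ⟩
  2 + dist w x₁   ≡⟨ cong (2 +_) (adjacent-to-w x₁ dist-x₁ wt-x₁) ⟩
  2 + k           ∎)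
  where
  open Separation sep
  open ≡-Reasoning
  adjacent-to-w : ∀ x → dist u x ≡ j + suc m → wt x ≡ j + m → dist w x ≡ k
  adjacent-to-w x d t =
    let u~x , x∈W = neighbour-in-W u x k≡1+m+j d t
    in Equivalence.to (same-neighbours x x∈W) u~x
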